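{- Let $t\ge2$ be an even integer and let $p$ be an odd prime with $(t-1)\mid(p-1)$; write $p-1=a(t-1)$ (so $a$ is even). Let $g$ be a primitive root of $\mathbb{F}_p$ (a generator of $\mathbb{F}_p^*$), and set \[ B=\{g,g^2,\dots,g^{a/2}\}\subseteq \mathbb{F}_p^*,\qquad W=\{a,2a,\dots,(t-1)a\}\subseteq\mathbb{Z}. \] For $f\in\mathbb{F}_p^*$ define \[ P_f=\{(w,b)\in W\times B : g^w b=f\},\qquad N_f=\{(w,b)\in W\times B : g^w b=-f\}. \] Then for every $f\in\mathbb{F}_p^*$ we have $\{|P_f|,|N_f|\}=\{0,1\}$; in particular each of $P_f$ and $N_f$ has at most one element.
   Context: $\mathbb{F}_p$ is the finite field with $p$ elements and $\mathbb{F}_p^*$ its multiplicative group. -}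

module Defs where

open import Data.Nat using (ℕ; zero; suc; _+_; _*_; _∸_; _^_; _≤_; _<_; NonZero)
open import Data.Nat.DivMod using (_%_; _/_)
open import Data.Nat.Properties using (_≟_)
open import Data.List using (List; map; filter; length; cartesianProduct)
open import Data.List.Base using (upTo)
open import Data.Product using (_×_; _,_; proj₁; proj₂)
open import Relation.Binary.PropositionalEquality using (_≡_; _≢_)

-- Elements of 𝔽_p are represented by their canonical residues 0,…,p-1 in ℕ;
-- multiplication in 𝔽_p is (x * y) % p.

range : ℕ → ℕ → List ℕ
range m n = map (m +_) (upTo (suc n ∸ m))

IsPrimitiveRoot : (p g : ℕ) → .{{NonZero p}} → Set
IsPrimitiveRoot p g = (1 ≤ g) × (g < p) × (∀ k → 1 ≤ k → k < p ∸ 1 → (g ^ k) % p ≢ 1)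

W : (t a : ℕ) → List ℕ
W t a = map (λ i → i * a) (range 1 (t ∸ 1))

B : (p g a : ℕ) → .{{NonZero p}} → List ℕ
B p g a = map (λ j → (g ^ j) % p) (range 1 (a / 2))

pairsTo : (p g t a x : ℕ) → .{{NonZero p}} → List (ℕ × ℕ)
pairsTo p g t a x =
  filter (λ wb → ((g ^ proj₁ wb) * proj₂ wb) % p ≟ x) (cartesianProduct (W t a) (B p g a))

-- P_f : g^w b = f ;  N_f : g^w b = -f  (−f = p − f in 𝔽_p, for f ∈ 𝔽_p^*)
P : (p g t a f : ℕ) → .{{NonZero p}} → List (ℕ × ℕ)
P p g t a f = pairsTo p g t a f

N : (p g t a f : ℕ) → .{{NonZero p}} → List (ℕ × ℕ)
N p g t a f = pairsTo p g t a (p ∸ f)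

-- Put n = p − 1, m = t − 1 (odd), a = 2b and h = n/2 = m b. Since g has order n, e ↦ g^e
-- is injective on every window of n consecutive exponents; as g^h squares to 1 it is −1,
-- and therefore g^x = ±g^y exactly when x ≡ y (mod h). A pair (i a, g^j) ∈ W × B has
-- product g^(i a + j), and modulo h the exponent i a + (j − 1) is (2i mod m) b + (j − 1).
-- As 2 is invertible modulo the odd m, these residues run through ℤ/h exactly once, so
-- exactly one pair has product ±f; it cannot be both, because f ≠ −f for odd p.

module Submission where

open import Defs
open import Data.Bool using (true; false)
open import Data.Fin as Fin using (Fin; toℕ; fromℕ<)
open import Data.Fin.Properties using (pigeonhole; toℕ<n; fromℕ<-injective)
open import Data.List using (List; []; _∷_; _++_; length; map; filter; cartesianProduct)
open import Data.List.Properties using (map-∘; map-++; length-map; filter-none)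
open import Data.List.Membership.Propositional using (_∈_)
open import Data.List.Membership.Propositional.Properties
  using (∈-map⁺; ∈-map⁻; ∈-upTo⁺; ∈-upTo⁻; ∈-cartesianProduct⁺; ∈-cartesianProduct⁻)
open import Data.List.Relation.Unary.All as All using ()
open import Data.List.Relation.Unary.AllPairs using (_∷_)
open import Data.List.Relation.Unary.Any using (here; there)
open import Data.List.Relation.Unary.Unique.Propositional using (Unique)
open import Data.List.Relation.Unary.Unique.Propositional.Properties
  using (map⁺; upTo⁺; cartesianProduct⁺)
open import Data.Nat
  using (ℕ; zero; suc; _+_; _*_; _∸_; _^_; _≤_; _<_; z≤n; s≤s; s≤s⁻¹; s<s⁻¹; _≟_;
         NonZero; >-nonZero; >-nonZero⁻¹; ≢-nonZero⁻¹)
open import Data.Nat.Properties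
open import Data.Nat.DivMod
open import Data.Nat.Divisibility
  using (_∣_; _∤_; divides; _∣0; ∣-refl; ∣1⇒≡1; ∣⇒≤; >⇒∤; m%n≡0⇒n∣m; n∣m*n; ∣m∣n⇒∣m+n)
open import Data.Nat.Coprimality as Coprime using (Coprime; 1-coprimeTo; coprime-+; coprime-divisor)
open import Data.Nat.Primality using (Prime; euclidsLemma; prime⇒irreducible; ¬prime[0]; ¬prime[1])
open import Data.Nat.Tactic.RingSolver using (solve-∀)
open import Data.Product as Product using (_×_; _,_; proj₁; proj₂; ∃-syntax)
open import Data.Sum as Sum using (_⊎_; inj₁; inj₂)
open import Function.Base using (_∘_)
open import Function.Bundles using (_⇔_; mk⇔; Equivalence)
open import Level using (0ℓ)
open import Relation.Nullary using (¬_; Dec; does; yes; no; contradiction)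
open import Relation.Unary using (Pred; Decidable)
open import Relation.Unary.Properties using (_∪?_)
open import Relation.Binary.PropositionalEquality
  using (_≡_; _≢_; refl; sym; trans; cong; cong₂; subst; subst₂; module ≡-Reasoning)
open ≡-Reasoning

%≡%⇒∣∸ : ∀ m o n .{{_ : NonZero n}} → m % n ≡ o % n → n ∣ o ∸ m
%≡%⇒∣∸ m o n eq = divides (o / n ∸ m / n) (begin
  o ∸ m                                     ≡⟨ cong₂ _∸_ (m≡m%n+[m/n]*n o n) (m≡m%n+[m/n]*n m n) ⟩
  (o % n + o / n * n) ∸ (m % n + m / n * n) ≡⟨ cong (λ r → (o % n + o / n * n) ∸ (r + m / n * n)) eq ⟩
  (o % n + o / n * n) ∸ (o % n + m / n * n) ≡⟨ [m+n]∸[m+o]≡n∸o (o % n) _ _ ⟩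
  o / n * n ∸ m / n * n                     ≡⟨ *-distribʳ-∸ n (o / n) (m / n) ⟨
  (o / n ∸ m / n) * n                       ∎)

∣∸⇒%≡% : ∀ m o n .{{_ : NonZero n}} → m ≤ o → n ∣ o ∸ m → m % n ≡ o % n
∣∸⇒%≡% m o n m≤o n∣o∸m = begin
  m % n             ≡⟨ %-remove-+ʳ m n∣o∸m ⟨
  (m + (o ∸ m)) % n ≡⟨ cong (_% n) (m+[n∸m]≡n m≤o) ⟩
  o % n             ∎

%-cong-+ˡ : ∀ k {m o} n .{{_ : NonZero n}} → m % n ≡ o % n → (k + m) % n ≡ (k + o) % n
%-cong-+ˡ k {m} {o} n eq = begin
  (k + m) % n         ≡⟨ %-distribˡ-+ k m n ⟩
  (k % n + m % n) % n ≡⟨ cong (λ r → (k % n + r) % n) eq ⟩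
  (k % n + o % n) % n ≡⟨ %-distribˡ-+ k o n ⟨
  (k + o) % n         ∎

%-cong-*ˡ : ∀ k {m o} n .{{_ : NonZero n}} → m % n ≡ o % n → (k * m) % n ≡ (k * o) % n
%-cong-*ˡ k {m} {o} n eq = begin
  (k * m) % n           ≡⟨ %-distribˡ-* k m n ⟩
  (k % n * (m % n)) % n ≡⟨ cong (λ r → (k % n * r) % n) eq ⟩
  (k % n * (o % n)) % n ≡⟨ %-distribˡ-* k o n ⟨
  (k * o) % n           ∎

%-cancel-+ˡ : ∀ k {m o} n .{{_ : NonZero n}} → (k + m) % n ≡ (k + o) % n → m % n ≡ o % n
%-cancel-+ˡ k {m} {o} n eq with ≤-total m o
... | inj₁ m≤o = ∣∸⇒%≡% m o n m≤o
                   (subst (n ∣_) ([m+n]∸[m+o]≡n∸o k o m) (%≡%⇒∣∸ (k + m) (k + o) n eq))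
... | inj₂ o≤m = sym (∣∸⇒%≡% o m n o≤m
                   (subst (n ∣_) ([m+n]∸[m+o]≡n∸o k m o) (%≡%⇒∣∸ (k + o) (k + m) n (sym eq))))

∣∧<⇒≡0 : ∀ {m d} → m ∣ d → d < m → d ≡ 0
∣∧<⇒≡0 {d = zero}  _   _   = refl
∣∧<⇒≡0 {d = suc d} m∣d d<m = contradiction m∣d (>⇒∤ d<m)

[c*n]%[1+n]+c≡1+n : ∀ {c n} → 1 ≤ c → c ≤ n → (c * n) % suc n + c ≡ suc n
[c*n]%[1+n]+c≡1+n {suc c} {n} _ c<n =
  subst (λ n → (suc c * n) % suc n + suc c ≡ suc n) (m+[n∸m]≡n (<⇒≤ c<n)) (at-c+e c (n ∸ c))
  where
  at-c+e : ∀ c e → (suc c * (c + e)) % suc (c + e) + suc c ≡ suc (c + e)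
  at-c+e c e = begin
    (suc c * (c + e)) % suc (c + e) + suc c     ≡⟨ cong (λ z → z % suc (c + e) + suc c) (expand c e) ⟩
    (e + c * suc (c + e)) % suc (c + e) + suc c ≡⟨ cong (_+ suc c) ([m+kn]%n≡m%n e c (suc (c + e))) ⟩
    e % suc (c + e) + suc c                     ≡⟨ cong (_+ suc c) (m≤n⇒m%n≡m (m≤n+m e c)) ⟩
    e + suc c                                   ≡⟨ +-suc e c ⟩
    suc (e + c)                                 ≡⟨ cong suc (+-comm e c) ⟩
    suc (c + e)                                 ∎
    where
    expand : ∀ c e → suc c * (c + e) ≡ e + c * suc (c + e)
    expand = solve-∀

square≡1⇒≡±1 : ∀ {n x} → Prime (suc n) → x < suc n → (x * x) % suc n ≡ 1 → x ≡ 1 ⊎ x ≡ n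
square≡1⇒≡±1 {n} {zero}  _     _   ()
square≡1⇒≡±1 {n} {suc y} p-prime x<p x²≡1
  with euclidsLemma y (suc (suc y)) p-prime
         (subst (suc n ∣_) (expand y) (%≡%⇒∣∸ 1 (suc y * suc y) (suc n) 1≡x²))
  where
  1≡x² : 1 % suc n ≡ (suc y * suc y) % suc n
  1≡x² = trans (cong (_% suc n) (sym x²≡1)) (m%n%n≡m%n (suc y * suc y) (suc n))
  expand : ∀ y → y + y * suc y ≡ y * suc (suc y)
  expand = solve-∀
... | inj₁ p∣y   = inj₁ (cong suc (∣∧<⇒≡0 p∣y (<-trans (n<1+n y) x<p)))
... | inj₂ p∣y+2 = inj₂ (suc-injective (≤-antisym x<p (∣⇒≤ p∣y+2)))

odd-coprimeTo-2 : ∀ s → Coprime (suc (s * 2)) 2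
odd-coprimeTo-2 zero    = 1-coprimeTo 2
odd-coprimeTo-2 (suc s) = coprime-+ (odd-coprimeTo-2 s)

prime≢2⇒2∤ : ∀ {p} → Prime p → p ≢ 2 → 2 ∤ p
prime≢2⇒2∤ p-prime p≢2 2∣p with prime⇒irreducible p-prime 2∣p
... | inj₁ ()
... | inj₂ 2≡p = p≢2 (sym 2≡p)

2∤1+n⇒2∣n : ∀ n → 2 ∤ suc n → 2 ∣ n
2∤1+n⇒2∣n zero          _     = 2 ∣0
2∤1+n⇒2∣n (suc zero)    2∤2   = contradiction ∣-refl 2∤2
2∤1+n⇒2∣n (suc (suc n)) 2∤3+n = ∣m∣n⇒∣m+n ∣-refl (2∤1+n⇒2∣n n (2∤3+n ∘ ∣m∣n⇒∣m+n ∣-refl))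

m+n≡1⇒[0,1]⊎[1,0] : ∀ {m n} → m + n ≡ 1 → (m ≡ 0 × n ≡ 1) ⊎ (m ≡ 1 × n ≡ 0)
m+n≡1⇒[0,1]⊎[1,0] {zero}            eq = inj₁ (refl , eq)
m+n≡1⇒[0,1]⊎[1,0] {suc zero} {zero} _  = inj₂ (refl , refl)

module PrimitiveRoot {n g : ℕ} (p-prime : Prime (suc n)) (root : IsPrimitiveRoot (suc n) g) where

  p : ℕ
  p = suc n

  exp : ℕ → ℕ
  exp e = g ^ e % p

  private
    1≤g : 1 ≤ g
    1≤g = proj₁ root

    g<p : g < p
    g<p = proj₁ (proj₂ root)

    1<p : 1 < p
    1<p = ≤-<-trans 1≤g g<p

    instance
      n≢0 : NonZero n
      n≢0 = >-nonZero (s≤s⁻¹ 1<p)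

  exp≡1⇒≡0 : ∀ {d} → d < n → exp d ≡ 1 → d ≡ 0
  exp≡1⇒≡0 {zero}  _   _     = refl
  exp≡1⇒≡0 {suc d} d<n exp≡1 = contradiction exp≡1 (proj₂ (proj₂ root) (suc d) (s≤s z≤n) d<n)

  p∤g^ : ∀ e → p ∤ g ^ e
  p∤g^ zero    p∣1 = <⇒≢ 1<p (sym (∣1⇒≡1 p∣1))
  p∤g^ (suc e) p∣g^1+e with euclidsLemma g (g ^ e) p-prime p∣g^1+e
  ... | inj₁ p∣g   = <⇒≱ g<p (∣⇒≤ {{>-nonZero 1≤g}} p∣g)
  ... | inj₂ p∣g^e = p∤g^ e p∣g^e

  exp≥1 : ∀ e → 1 ≤ exp e
  exp≥1 e = n≢0⇒n>0 (λ exp≡0 → p∤g^ e (m%n≡0⇒n∣m (g ^ e) p exp≡0))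

  exp<p : ∀ e → exp e < p
  exp<p e = m%n<n (g ^ e) p

  exp-+ : ∀ x y → exp (x + y) ≡ (exp x * exp y) % p
  exp-+ x y = trans (cong (_% p) (^-distribˡ-+-* g x y)) (%-distribˡ-* (g ^ x) (g ^ y) p)

  exp-cancelˡ : ∀ x d → exp x ≡ exp (x + d) → exp d ≡ 1
  exp-cancelˡ x d eq with euclidsLemma (g ^ x) (g ^ d ∸ 1) p-prime (subst (p ∣_) factor p∣difference)
    where
    p∣difference : p ∣ g ^ (x + d) ∸ g ^ x
    p∣difference = %≡%⇒∣∸ (g ^ x) (g ^ (x + d)) p eq
    factor : g ^ (x + d) ∸ g ^ x ≡ g ^ x * (g ^ d ∸ 1)
    factor = begin
      g ^ (x + d) ∸ g ^ x       ≡⟨ cong₂ _∸_ (sym (^-distribˡ-+-* g x d)) (*-identityʳ (g ^ x)) ⟨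
      g ^ x * g ^ d ∸ g ^ x * 1 ≡⟨ *-distribˡ-∸ (g ^ x) (g ^ d) 1 ⟨
      g ^ x * (g ^ d ∸ 1)       ∎
  ... | inj₁ p∣g^x    = contradiction p∣g^x (p∤g^ x)
  ... | inj₂ p∣g^d∸1 = trans (sym (∣∸⇒%≡% 1 (g ^ d) p (m^n>0 g {{>-nonZero 1≤g}} d) p∣g^d∸1))
                             (m<n⇒m%n≡m 1<p)

  exp-injective : ∀ {x y} → x ≤ y → y < x + n → exp x ≡ exp y → x ≡ y
  exp-injective {x} {y} x≤y y<x+n eq = begin
    x           ≡⟨ +-identityʳ x ⟨
    x + 0       ≡⟨ cong (x +_) (exp≡1⇒≡0 (m<n+o⇒m∸n<o y x y<x+n) (exp-cancelˡ x (y ∸ x) eq′)) ⟨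
    x + (y ∸ x) ≡⟨ m+[n∸m]≡n x≤y ⟩
    y           ∎
    where
    eq′ : exp x ≡ exp (x + (y ∸ x))
    eq′ = trans eq (cong exp (sym (m+[n∸m]≡n x≤y)))

  private
    toFin : ∀ v → 1 ≤ v → v < p → Fin n
    toFin (suc w) _ w<p = fromℕ< (s≤s⁻¹ w<p)

    toFin-injective : ∀ {u v} (1≤u : 1 ≤ u) (u<p : u < p) (1≤v : 1 ≤ v) (v<p : v < p) →
                      toFin u 1≤u u<p ≡ toFin v 1≤v v<p → u ≡ v
    toFin-injective {suc u} {suc v} _ _ _ _ eq = cong suc (fromℕ<-injective u v _ _ eq)

  -- Pigeonhole: f, g^1, …, g^n are n + 1 nonzero residues, and no two powers coincide.
  exp-surjective : ∀ {f} → 1 ≤ f → f < p → ∃[ e ] e < n × exp (suc e) ≡ f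
  exp-surjective {f} 1≤f f<p with pigeonhole (n<1+n n) slot
    where
    slot : Fin (suc n) → Fin n
    slot Fin.zero    = toFin f 1≤f f<p
    slot (Fin.suc i) = toFin (exp (suc (toℕ i))) (exp≥1 (suc (toℕ i))) (exp<p (suc (toℕ i)))
  ... | Fin.zero  , Fin.suc j , _   , f≡ = toℕ j , toℕ<n j , sym (toFin-injective _ _ _ _ f≡)
  ... | Fin.suc i , Fin.suc j , i<j , e≡ =
    contradiction (suc-injective (exp-injective (<⇒≤ i<j) j<i+n (toFin-injective _ _ _ _ e≡)))
                  (<⇒≢ (s<s⁻¹ i<j))
    where
    j<i+n : suc (toℕ j) < suc (toℕ i) + n
    j<i+n = s≤s (≤-trans (toℕ<n j) (m≤n+m n (toℕ i)))

  exp[n]≡1 : exp n ≡ 1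
  exp[n]≡1 with exp-surjective {1} ≤-refl 1<p
  ... | e , e<n , exp≡1 with m≤n⇒m<n∨m≡n e<n
  ...   | inj₁ 1+e<n = contradiction (exp≡1⇒≡0 1+e<n exp≡1) λ ()
  ...   | inj₂ refl  = exp≡1

  -- u ≈± v says u = ±v in 𝔽_p; the sum form of −v avoids truncated subtraction.
  infix 4 _≈±_
  _≈±_ : ℕ → ℕ → Set
  u ≈± v = u ≡ v ⊎ u + v ≡ p

  ≈±-sym : ∀ {u v} → u ≈± v → v ≈± u
  ≈±-sym         (inj₁ u≡v)   = inj₁ (sym u≡v)
  ≈±-sym {u} {v} (inj₂ u+v≡p) = inj₂ (trans (+-comm v u) u+v≡p)

  ≈±-trans : ∀ {u v w} → u ≈± v → v ≈± w → u ≈± w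
  ≈±-trans (inj₁ refl)  v≈±w        = v≈±w
  ≈±-trans (inj₂ u+v≡p) (inj₁ refl) = inj₂ u+v≡p
  ≈±-trans {u} {v} {w} (inj₂ u+v≡p) (inj₂ v+w≡p) =
    inj₁ (+-cancelʳ-≡ v u w (trans u+v≡p (trans (sym v+w≡p) (+-comm v w))))

  ≈±⇔≡⊎≡p∸ : ∀ {u v} → v ≤ p → u ≈± v ⇔ (u ≡ v ⊎ u ≡ p ∸ v)
  ≈±⇔≡⊎≡p∸ {u} {v} v≤p = mk⇔
    (Sum.map₂ λ u+v≡p → trans (sym (m+n∸n≡m u v)) (cong (_∸ v) u+v≡p))
    (Sum.map₂ λ u≡p∸v → trans (cong (_+ v) u≡p∸v) (m∸n+n≡m v≤p))

  module Halving (h : ℕ) .{{_ : NonZero h}} (n≡h+h : n ≡ h + h) where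

    private
      h<n : h < n
      h<n = subst (h <_) (sym n≡h+h) (m<m+n h (>-nonZero⁻¹ h))

    exp[h]≡n : exp h ≡ n
    exp[h]≡n with square≡1⇒≡±1 p-prime (exp<p h) square≡1
      where
      square≡1 : (exp h * exp h) % p ≡ 1
      square≡1 = begin
        (exp h * exp h) % p ≡⟨ exp-+ h h ⟨
        exp (h + h)         ≡⟨ cong exp n≡h+h ⟨
        exp n               ≡⟨ exp[n]≡1 ⟩
        1                   ∎
    ... | inj₁ exp≡1 = contradiction (exp≡1⇒≡0 h<n exp≡1) (≢-nonZero⁻¹ h)
    ... | inj₂ exp≡n = exp≡n

    f+f≢p : ∀ f → f + f ≢ p
    f+f≢p f f+f≡p = even≢odd f h (begin
      f + (f + 0) ≡⟨ cong (f +_) (+-identityʳ f) ⟩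
      f + f       ≡⟨ f+f≡p ⟩
      suc n       ≡⟨ cong suc n≡h+h ⟩
      suc (h + h) ≡⟨ cong (λ z → suc (h + z)) (+-identityʳ h) ⟨
      suc (h + (h + 0)) ∎)

    exp[x+h]+exp[x]≡p : ∀ x → exp (x + h) + exp x ≡ p
    exp[x+h]+exp[x]≡p x = begin
      exp (x + h) + exp x         ≡⟨ cong (_+ exp x) (exp-+ x h) ⟩
      (exp x * exp h) % p + exp x ≡⟨ cong (λ z → (exp x * z) % p + exp x) exp[h]≡n ⟩
      (exp x * n) % p + exp x     ≡⟨ [c*n]%[1+n]+c≡1+n (exp≥1 x) (s≤s⁻¹ (exp<p x)) ⟩
      p                           ∎

    exp[x+q*h]≈±exp[x] : ∀ x q → exp (x + q * h) ≈± exp x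
    exp[x+q*h]≈±exp[x] x zero    = inj₁ (cong exp (+-identityʳ x))
    exp[x+q*h]≈±exp[x] x (suc q) =
      ≈±-trans (inj₂ (subst (λ y → exp y + exp (x + q * h) ≡ p) shift (exp[x+h]+exp[x]≡p (x + q * h))))
               (exp[x+q*h]≈±exp[x] x q)
      where
      shift : x + q * h + h ≡ x + suc q * h
      shift = trans (+-assoc x (q * h) h) (cong (x +_) (+-comm (q * h) h))

    exp≈±exp[%h] : ∀ x → exp x ≈± exp (x % h)
    exp≈±exp[%h] x = subst (λ y → exp y ≈± exp (x % h)) (sym (m≡m%n+[m/n]*n x h))
                           (exp[x+q*h]≈±exp[x] (x % h) (x / h))

    private
      exp-≈±-injective : ∀ {u v} → u < h → v < h → exp u ≈± exp v → u ≡ v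
      exp-≈±-injective {u} {v} u<h v<h (inj₁ eq) with ≤-total u v
      ... | inj₁ u≤v = exp-injective u≤v (<-≤-trans v<h (≤-trans (<⇒≤ h<n) (m≤n+m n u))) eq
      ... | inj₂ v≤u = sym (exp-injective v≤u (<-≤-trans u<h (≤-trans (<⇒≤ h<n) (m≤n+m n v))) (sym eq))
      exp-≈±-injective {u} {v} u<h v<h (inj₂ sum≡p) =
        contradiction u<h (≤⇒≯ (subst (h ≤_) (sym u≡v+h) (m≤n+m h v)))
        where
        v+h<u+n : v + h < u + n
        v+h<u+n = <-≤-trans (subst (v + h <_) (sym n≡h+h) (+-monoˡ-< h v<h)) (m≤n+m n u)
        u≡v+h : u ≡ v + h
        u≡v+h = exp-injective (≤-trans (<⇒≤ u<h) (m≤n+m h v)) v+h<u+n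
                  (+-cancelʳ-≡ (exp v) (exp u) (exp (v + h)) (trans sum≡p (sym (exp[x+h]+exp[x]≡p v))))

    exp-≈±⇔≡[mod] : ∀ x y → exp x ≈± exp y ⇔ x % h ≡ y % h
    exp-≈±⇔≡[mod] x y = mk⇔
      (λ x≈±y → exp-≈±-injective (m%n<n x h) (m%n<n y h)
                  (≈±-trans (≈±-sym (exp≈±exp[%h] x)) (≈±-trans x≈±y (exp≈±exp[%h] y))))
      (λ x≡y → ≈±-trans (exp≈±exp[%h] x)
                  (≈±-trans (inj₁ (cong exp x≡y)) (≈±-sym (exp≈±exp[%h] y))))

module MixedRadix (s b : ℕ) .{{_ : NonZero b}} where

  m : ℕ
  m = suc (s * 2)

  a : ℕ
  a = b * 2

  h : ℕ
  h = m * b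

  instance
    h≢0 : NonZero h
    h≢0 = m*n≢0 m b

  private
    doubling-injective-≤ : ∀ {i j} → 1 ≤ i → j ≤ m → i ≤ j → 2 * i % m ≡ 2 * j % m → i ≡ j
    doubling-injective-≤ {i} {j} 1≤i j≤m i≤j eq = ≤-antisym i≤j (m∸n≡0⇒m≤n (∣∧<⇒≡0 m∣j∸i j∸i<m))
      where
      m∣j∸i : m ∣ j ∸ i
      m∣j∸i = coprime-divisor (odd-coprimeTo-2 s)
                (subst (m ∣_) (sym (*-distribˡ-∸ 2 j i)) (%≡%⇒∣∸ (2 * i) (2 * j) m eq))
      j∸i<m : j ∸ i < m
      j∸i<m = m<n+o⇒m∸n<o j i (<-≤-trans (s≤s j≤m) (+-monoˡ-≤ m 1≤i))

  doubling-injective : ∀ {i j} → 1 ≤ i → i ≤ m → 1 ≤ j → j ≤ m → 2 * i % m ≡ 2 * j % m → i ≡ j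
  doubling-injective {i} {j} 1≤i i≤m 1≤j j≤m eq with ≤-total i j
  ... | inj₁ i≤j = doubling-injective-≤ 1≤i j≤m i≤j eq
  ... | inj₂ j≤i = sym (doubling-injective-≤ 1≤j i≤m j≤i (sym eq))

  doubling-surjective : ∀ {k} → k < m → ∃[ i ] (1 ≤ i × i ≤ m) × 2 * i % m ≡ k
  doubling-surjective {k} k<m = suc (x % m) , (s≤s z≤n , m%n<n x m) , (begin
    2 * suc (x % m) % m   ≡⟨ %-cong-*ˡ 2 {suc (x % m)} {suc x} m (%-cong-+ˡ 1 {x % m} {x} m (m%n%n≡m%n x m)) ⟩
    2 * suc x % m         ≡⟨ cong (_% m) (expand k s) ⟩
    (k + (k + 2) * m) % m ≡⟨ [m+kn]%n≡m%n k (k + 2) m ⟩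
    k % m                 ≡⟨ m<n⇒m%n≡m k<m ⟩
    k                     ∎)
    where
    -- s + 1 inverts 2 modulo m = 2s + 1; the witness is (s + 1) k taken in [1, m],
    -- i.e. 1 + ((s + 1) k + 2s) mod m.
    x : ℕ
    x = k * suc s + s * 2
    expand : ∀ k s → 2 * suc (k * suc s + s * 2) ≡ k + (k + 2) * suc (s * 2)
    expand = solve-∀

  residue : ∀ i {o} → o < b → (i * a + o) % h ≡ 2 * i % m * b + o
  residue i {o} o<b = begin
    (i * a + o) % h     ≡⟨ cong (λ z → (z + o) % h) (reassoc i b) ⟩
    (2 * i * b + o) % h ≡⟨ [m*n+o]%[p*n]≡[m*n]%[p*n]+o (2 * i) m o<b ⟩
    (2 * i * b) % h + o ≡⟨ cong (_+ o) (m%n*o≡m*o%[n*o] (2 * i) m b) ⟨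
    2 * i % m * b + o   ∎
    where
    reassoc : ∀ i b → i * (b * 2) ≡ 2 * i * b
    reassoc = solve-∀

  digits-injective : ∀ {K K′ o o′} → o < b → o′ < b → K * b + o ≡ K′ * b + o′ → K ≡ K′ × o ≡ o′
  digits-injective {K} {K′} {o} {o′} o<b o′<b eq = K≡K′ , o≡o′
    where
    low-digit : ∀ K {o} → o < b → (K * b + o) % b ≡ o
    low-digit K o<b = trans (%-remove-+ˡ _ (n∣m*n K)) (m<n⇒m%n≡m o<b)
    o≡o′ : o ≡ o′
    o≡o′ = trans (sym (low-digit K o<b)) (trans (cong (_% b) eq) (low-digit K′ o′<b))
    K≡K′ : K ≡ K′
    K≡K′ = *-cancelʳ-≡ K K′ b (+-cancelʳ-≡ o (K * b) (K′ * b) (trans eq (cong (K′ * b +_) (sym o≡o′))))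

  residue-injective : ∀ {i i′ o o′} → 1 ≤ i → i ≤ m → 1 ≤ i′ → i′ ≤ m → o < b → o′ < b →
                      (i * a + o) % h ≡ (i′ * a + o′) % h → i ≡ i′ × o ≡ o′
  residue-injective {i} {i′} 1≤i i≤m 1≤i′ i′≤m o<b o′<b eq
    with digits-injective o<b o′<b (trans (sym (residue i o<b)) (trans eq (residue i′ o′<b)))
  ... | 2i≡2i′ , o≡o′ = doubling-injective 1≤i i≤m 1≤i′ i′≤m 2i≡2i′ , o≡o′

  residue-surjective : ∀ c → ∃[ i ] ∃[ o ] (1 ≤ i × i ≤ m) × o < b × (i * a + o) % h ≡ c % h
  residue-surjective c with doubling-surjective {c % h / b} (m<n*o⇒m/o<n (m%n<n c h))
  ... | i , i-bounds , 2i≡K = i , c % h % b , i-bounds , m%n<n (c % h) b , (begin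
    (i * a + c % h % b) % h   ≡⟨ residue i (m%n<n (c % h) b) ⟩
    2 * i % m * b + c % h % b ≡⟨ cong (λ K → K * b + c % h % b) 2i≡K ⟩
    c % h / b * b + c % h % b ≡⟨ +-comm (c % h / b * b) (c % h % b) ⟩
    c % h % b + c % h / b * b ≡⟨ m≡m%n+[m/n]*n (c % h) b ⟨
    c % h                     ∎)

∈-range⁺ : ∀ {k M} → 1 ≤ k → k ≤ M → k ∈ range 1 M
∈-range⁺ {suc k} _ k<M = ∈-map⁺ (1 +_) (∈-upTo⁺ k<M)

∈-range⁻ : ∀ {k M} → k ∈ range 1 M → 1 ≤ k × k ≤ M
∈-range⁻ k∈ with ∈-map⁻ (1 +_) k∈
... | _ , j∈ , refl = s≤s z≤n , ∈-upTo⁻ j∈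

range-unique : ∀ M → Unique (range 1 M)
range-unique M = map⁺ suc-injective (upTo⁺ M)

cartesianProduct-map : ∀ {A B C D : Set} (f : A → C) (g : B → D) xs ys →
                       cartesianProduct (map f xs) (map g ys) ≡ map (Product.map f g) (cartesianProduct xs ys)
cartesianProduct-map f g []       ys = refl
cartesianProduct-map f g (x ∷ xs) ys = begin
  map (f x ,_) (map g ys) ++ cartesianProduct (map f xs) (map g ys)
    ≡⟨ cong₂ _++_ (sym (map-∘ ys)) (cartesianProduct-map f g xs ys) ⟩
  map (Product.map f g ∘ (x ,_)) ys ++ map (Product.map f g) (cartesianProduct xs ys)
    ≡⟨ cong (_++ _) (map-∘ ys) ⟩
  map (Product.map f g) (map (x ,_) ys) ++ map (Product.map f g) (cartesianProduct xs ys)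
    ≡⟨ map-++ (Product.map f g) (map (x ,_) ys) (cartesianProduct xs ys) ⟨
  map (Product.map f g) (cartesianProduct (x ∷ xs) ys)
    ∎

module _ {A : Set} where

  filter-map : ∀ {B : Set} {Q : Pred B 0ℓ} (Q? : Decidable Q) (f : A → B) xs →
               filter Q? (map f xs) ≡ map f (filter (Q? ∘ f) xs)
  filter-map Q? f []       = refl
  filter-map Q? f (x ∷ xs) with does (Q? (f x))
  ... | true  = cong (f x ∷_) (filter-map Q? f xs)
  ... | false = filter-map Q? f xs

  length-filter-∪ : ∀ {Q R : Pred A 0ℓ} (Q? : Decidable Q) (R? : Decidable R) →
                    (∀ {x} → Q x → ¬ R x) → ∀ xs →
                    length (filter Q? xs) + length (filter R? xs) ≡ length (filter (Q? ∪? R?) xs)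
  length-filter-∪ Q? R? disjoint []       = refl
  length-filter-∪ Q? R? disjoint (x ∷ xs) with Q? x | R? x
  ... | yes qx | yes rx = contradiction rx (disjoint qx)
  ... | yes _  | no _   = cong suc (length-filter-∪ Q? R? disjoint xs)
  ... | no _   | yes _  = trans (+-suc _ _) (cong suc (length-filter-∪ Q? R? disjoint xs))
  ... | no _   | no _   = length-filter-∪ Q? R? disjoint xs

  length-filter≡1 : ∀ {Q : Pred A 0ℓ} (Q? : Decidable Q) {x xs} → Unique xs → x ∈ xs → Q x →
                    (∀ {y} → y ∈ xs → Q y → y ≡ x) → length (filter Q? xs) ≡ 1
  length-filter≡1 {Q} Q? {x} {z ∷ xs} (z≢xs ∷ unique) x∈ qx only-x with Q? z
  ... | yes qz = cong suc (cong length (filter-none Q? (All.tabulate rest-rejected)))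
    where
    rest-rejected : ∀ {y} → y ∈ xs → ¬ Q y
    rest-rejected {y} y∈xs qy =
      All.lookup z≢xs y∈xs (trans (only-x (here refl) qz) (sym (only-x (there y∈xs) qy)))
  ... | no ¬qz with x∈
  ...   | here refl  = contradiction qx ¬qz
  ...   | there x∈xs = length-filter≡1 Q? unique x∈xs qx (only-x ∘ there)

module Count {n g : ℕ} (p-prime : Prime (suc n)) (root : IsPrimitiveRoot (suc n) g)
             (s b : ℕ) .{{_ : NonZero b}} (n≡a*m : n ≡ b * 2 * suc (s * 2)) where

  open PrimitiveRoot p-prime root
  open MixedRadix s b

  n≡h+h : n ≡ h + h
  n≡h+h = trans n≡a*m (regroup b s)
    where
    regroup : ∀ b s → b * 2 * suc (s * 2) ≡ suc (s * 2) * b + suc (s * 2) * b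
    regroup = solve-∀

  open Halving h n≡h+h

  t : ℕ
  t = suc s * 2

  indices : List (ℕ × ℕ)
  indices = cartesianProduct (range 1 m) (range 1 b)

  pairValue : ℕ × ℕ → ℕ
  pairValue x = (g ^ (proj₁ x * a) * (g ^ proj₂ x % p)) % p

  pairValue≡exp : ∀ i o → pairValue (i , suc o) ≡ exp (suc (i * a + o))
  pairValue≡exp i o = begin
    (g ^ (i * a) * (g ^ suc o % p)) % p
      ≡⟨ %-cong-*ˡ (g ^ (i * a)) {g ^ suc o % p} {g ^ suc o} p (m%n%n≡m%n (g ^ suc o) p) ⟩
    (g ^ (i * a) * g ^ suc o) % p       ≡⟨ cong (_% p) (^-distribˡ-+-* g (i * a) (suc o)) ⟨
    exp (i * a + suc o)                 ≡⟨ cong exp (+-suc (i * a) o) ⟩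
    exp (suc (i * a + o))               ∎

  ∈-indices⁻ : ∀ {i j} → (i , j) ∈ indices → (1 ≤ i × i ≤ m) × (1 ≤ j × j ≤ b)
  ∈-indices⁻ ij∈ = Product.map ∈-range⁻ ∈-range⁻ (∈-cartesianProduct⁻ (range 1 m) (range 1 b) ij∈)

  pairValue-≈±-injective : ∀ {x y} → x ∈ indices → y ∈ indices → pairValue x ≈± pairValue y → x ≡ y
  pairValue-≈±-injective {i , j} {i′ , j′} x∈ y∈ x≈±y with ∈-indices⁻ x∈ | ∈-indices⁻ y∈
  ... | (1≤i , i≤m) , (s≤s z≤n , o<b) | (1≤i′ , i′≤m) , (s≤s z≤n , o′<b)
    with residue-injective 1≤i i≤m 1≤i′ i′≤m o<b o′<b
           (%-cancel-+ˡ 1 h (Equivalence.to (exp-≈±⇔≡[mod] _ _)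
             (subst₂ _≈±_ (pairValue≡exp i _) (pairValue≡exp i′ _) x≈±y)))
  ... | refl , refl = refl

  pairValue-≈±-surjective : ∀ {f} → 1 ≤ f → f < p → ∃[ x ] x ∈ indices × pairValue x ≈± f
  pairValue-≈±-surjective 1≤f f<p with exp-surjective 1≤f f<p
  ... | c , _ , exp≡f with residue-surjective c
  ...   | i , o , (1≤i , i≤m) , o<b , residue≡c =
    (i , suc o) ,
    ∈-cartesianProduct⁺ (∈-range⁺ 1≤i i≤m) (∈-range⁺ (s≤s z≤n) o<b) ,
    subst₂ _≈±_ (sym (pairValue≡exp i o)) exp≡f
      (Equivalence.from (exp-≈±⇔≡[mod] _ _) (%-cong-+ˡ 1 h residue≡c))

  length-pairsTo : ∀ c → length (pairsTo p g t a c) ≡ length (filter (λ x → pairValue x ≟ c) indices)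
  length-pairsTo c = begin
    length (filter D (cartesianProduct (map α (range 1 m)) (map β (range 1 (a / 2)))))
      ≡⟨ cong (λ k → length (filter D (cartesianProduct (map α (range 1 m)) (map β (range 1 k)))))
              (m*n/n≡m b 2) ⟩
    length (filter D (cartesianProduct (map α (range 1 m)) (map β (range 1 b))))
      ≡⟨ cong (length ∘ filter D) (cartesianProduct-map α β (range 1 m) (range 1 b)) ⟩
    length (filter D (map (Product.map α β) indices))
      ≡⟨ cong length (filter-map D (Product.map α β) indices) ⟩
    length (map (Product.map α β) (filter (D ∘ Product.map α β) indices))
      ≡⟨ length-map (Product.map α β) (filter (D ∘ Product.map α β) indices) ⟩
    length (filter (λ x → pairValue x ≟ c) indices)
      ∎
    where
    α : ℕ → ℕ
    α i = i * a
    β : ℕ → ℕ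
    β j = g ^ j % p
    D : (wb : ℕ × ℕ) → Dec ((g ^ proj₁ wb * proj₂ wb) % p ≡ c)
    D wb = (g ^ proj₁ wb * proj₂ wb) % p ≟ c

  P+N≡1 : ∀ {f} → 1 ≤ f → f < p → length (P p g t a f) + length (N p g t a f) ≡ 1
  P+N≡1 {f} 1≤f f<p with pairValue-≈±-surjective 1≤f f<p
  ... | x , x∈ , x≈±f = begin
    length (P p g t a f) + length (N p g t a f)
      ≡⟨ cong₂ _+_ (length-pairsTo f) (length-pairsTo (p ∸ f)) ⟩
    length (filter is+f indices) + length (filter is-f indices)
      ≡⟨ length-filter-∪ is+f is-f (λ {y} → opposite-signs {y}) indices ⟩
    length (filter (is+f ∪? is-f) indices)
      ≡⟨ length-filter≡1 (is+f ∪? is-f) (cartesianProduct⁺ (range-unique m) (range-unique b)) x∈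
           (Equivalence.to (≈±⇔≡⊎≡p∸ f≤p) x≈±f) only-x ⟩
    1 ∎
    where
    f≤p : f ≤ p
    f≤p = <⇒≤ f<p
    is+f : Decidable (λ y → pairValue y ≡ f)
    is+f y = pairValue y ≟ f
    is-f : Decidable (λ y → pairValue y ≡ p ∸ f)
    is-f y = pairValue y ≟ p ∸ f
    opposite-signs : ∀ {y} → pairValue y ≡ f → pairValue y ≢ p ∸ f
    opposite-signs refl f≡p∸f = f+f≢p f (trans (cong (f +_) f≡p∸f) (m+[n∸m]≡n f≤p))
    only-x : ∀ {y} → y ∈ indices → pairValue y ≡ f ⊎ pairValue y ≡ p ∸ f → y ≡ x
    only-x y∈ y≈±f = pairValue-≈±-injective y∈ x∈
      (≈±-trans (Equivalence.from (≈±⇔≡⊎≡p∸ f≤p) y≈±f) (≈±-sym x≈±f))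

lemma1 : (t p a g : ℕ) → .{{_ : NonZero p}} →
         2 ≤ t → 2 ∣ t →
         Prime p → p ≢ 2 →
         (t ∸ 1) ∣ (p ∸ 1) → p ∸ 1 ≡ a * (t ∸ 1) →
         IsPrimitiveRoot p g →
         (f : ℕ) → 1 ≤ f → f < p →
         ((length (P p g t a f) ≡ 0) × (length (N p g t a f) ≡ 1))
         ⊎ ((length (P p g t a f) ≡ 1) × (length (N p g t a f) ≡ 0))
lemma1 _ zero _ _ _ _ p-prime _ _ _ _ _ _ _ = contradiction p-prime ¬prime[0]
lemma1 .(suc s * 2) (suc n) a g _ (divides (suc s) refl) p-prime p≢2 _ n≡a*m root f 1≤f f<p
  with coprime-divisor (Coprime.sym (odd-coprimeTo-2 s))
         (subst (2 ∣_) (trans n≡a*m (*-comm a _)) (2∤1+n⇒2∣n n (prime≢2⇒2∤ p-prime p≢2)))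
... | divides zero    refl = contradiction (subst (Prime ∘ suc) n≡a*m p-prime) ¬prime[1]
... | divides (suc b) refl = m+n≡1⇒[0,1]⊎[1,0] (Count.P+N≡1 p-prime root s (suc b) n≡a*m 1≤f f<p)
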